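{- Let $t\ge 2$ be an integer and let $F$ be a forest with connected components $F_1,\dots,F_k$. Assume there exists $\alpha>0$ such that for all sufficiently large $n$ and each $i\le k$, $\mathrm{ex}(n,F_i)<(1-\alpha)\,\mathrm{ex}(n,F)$. Then there exists $\alpha'>0$ such that for all sufficiently large $n$, $$\mathrm{ex}(n,M_t,F)<(1-\alpha')\,\frac{\mathrm{ex}(n,F)^t}{t!}.$$
   Context: $\mathcal{N}(H,G)$ denotes the number of subgraphs of $G$ isomorphic to $H$. $\mathrm{ex}(n,H,F)$ is the maximum of $\mathcal{N}(H,G)$ over $n$-vertex $F$-free graphs $G$, and $\mathrm{ex}(n,F)$ is the maximum number of edges of an $n$-vertex $F$-free graph. $M_t$ is the matching with $t$ pairwise vertex-disjoint edges. -}

module Defs where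

open import Data.Bool using (Bool; true; false; _∧_; if_then_else_)
open import Data.Nat using (ℕ; zero; suc; _+_; _*_; _^_; _≤_; _<ᵇ_; _≡ᵇ_; _!)
open import Data.Nat.Properties using (_!≢0)
open import Data.Fin using (Fin; zero; suc; toℕ; inject₁; fromℕ)
open import Data.List using (List; []; _∷_; sum; map; length; allFin; concatMap; filter)
open import Data.Product using (Σ; _×_; _,_; ∃; ∃-syntax)
open import Data.Integer using (+_)
open import Data.Rational using (ℚ; _/_)
open import Relation.Binary.PropositionalEquality using (_≡_)
open import Relation.Nullary using (¬_)
open import Function.Definitions using (Injective)

record Graph (V : Set) : Set where
  field
    adj    : V → V → Bool
    sym    : ∀ x y → adj x y ≡ adj y x
    irrefl : ∀ x → adj x x ≡ false
open Graph public

Contains : {V W : Set} → Graph W → Graph V → Set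
Contains {V} {W} G H =
  Σ (V → W) λ f → Injective _≡_ _≡_ f ×
    (∀ x y → adj H x y ≡ true → adj G (f x) (f y) ≡ true)

Free : {V W : Set} → Graph V → Graph W → Set
Free H G = ¬ Contains G H

data Walk {V : Set} (G : Graph V) : V → V → Set where
  here : ∀ {x} → Walk G x x
  step : ∀ {x y z} → adj G x y ≡ true → Walk G y z → Walk G x z

Connected : {V : Set} → Graph V → Set
Connected G = ∀ x y → Walk G x y

-- a cycle of length m+3: distinct vertices c₀,…,c_{m+2}, consecutive
-- ones adjacent and c_{m+2} adjacent to c₀
HasCycle : {V : Set} → Graph V → Set
HasCycle {V} G =
  Σ ℕ λ m → Σ (Fin (3 + m) → V) λ c → Injective _≡_ _≡_ c ×
    ((∀ (i : Fin (2 + m)) → adj G (c (inject₁ i)) (c (suc i)) ≡ true) ×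
     adj G (c (fromℕ (2 + m))) (c zero) ≡ true)

Acyclic : {V : Set} → Graph V → Set
Acyclic G = ¬ HasCycle G

IsTree : {s : ℕ} → Graph (Fin (suc s)) → Set
IsTree G = Connected G × Acyclic G

DisjointUnion : (k : ℕ) (vs : Fin k → ℕ) → ((i : Fin k) → Graph (Fin (suc (vs i))))
              → Graph (Σ (Fin k) λ i → Fin (suc (vs i)))
DisjointUnion k vs T = record { adj = a ; sym = s ; irrefl = r }
  where
  open import Data.Fin using (_≟_)
  open import Relation.Nullary using (yes; no)
  open import Relation.Binary.PropositionalEquality using (refl; sym)
  a : Σ (Fin k) (λ i → Fin (suc (vs i))) → Σ (Fin k) (λ i → Fin (suc (vs i))) → Bool
  a (i , x) (j , y) with i ≟ j
  ... | yes refl = adj (T i) x y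
  ... | no _     = false
  s : ∀ p q → a p q ≡ a q p
  s (i , x) (j , y) with i ≟ j | j ≟ i
  ... | yes refl | yes refl = Graph.sym (T i) x y
  ... | yes refl | no ne    = Data.Empty.⊥-elim (ne refl)
    where import Data.Empty
  ... | no ne    | yes refl = Data.Empty.⊥-elim (ne refl)
    where import Data.Empty
  ... | no _     | no _     = refl
  r : ∀ p → a p p ≡ false
  r (i , x) with i ≟ i
  ... | yes refl = irrefl (T i) x
  ... | no ne    = Data.Empty.⊥-elim (ne refl)
    where import Data.Empty

edgeList : {n : ℕ} → Graph (Fin n) → List (Fin n × Fin n)
edgeList {n} G =
  concatMap (λ i → concatMap (λ j →
      if (toℕ i <ᵇ toℕ j) ∧ adj G i j then (i , j) ∷ [] else []) (allFin n))
    (allFin n)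

edgeCount : {n : ℕ} → Graph (Fin n) → ℕ
edgeCount G = length (edgeList G)

choose : {A : Set} → ℕ → List A → List (List A)
choose zero    _        = [] ∷ []
choose (suc t) []       = []
choose (suc t) (x ∷ xs) = map (x ∷_) (choose t xs) ++' choose (suc t) xs
  where
  _++'_ : {B : Set} → List B → List B → List B
  [] ++' ys = ys
  (z ∷ zs) ++' ys = z ∷ (zs ++' ys)

neq : {n : ℕ} → Fin n → Fin n → Bool
neq a b = if toℕ a ≡ᵇ toℕ b then false else true

disjointEdges : {n : ℕ} → Fin n × Fin n → Fin n × Fin n → Bool
disjointEdges (a , b) (c , d) = neq a c ∧ neq a d ∧ neq b c ∧ neq b d

allB : {A : Set} → (A → Bool) → List A → Bool
allB p []       = true
allB p (x ∷ xs) = p x ∧ allB p xs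

pairwiseDisjoint : {n : ℕ} → List (Fin n × Fin n) → Bool
pairwiseDisjoint []       = true
pairwiseDisjoint (e ∷ es) = allB (disjointEdges e) es ∧ pairwiseDisjoint es

countTrue : {A : Set} → (A → Bool) → List A → ℕ
countTrue p []       = 0
countTrue p (x ∷ xs) = (if p x then 1 else 0) + countTrue p xs

-- 𝒩(M_t, G): number of copies of the matching M_t in G, i.e. number of
-- t-element sets of pairwise vertex-disjoint edges of G
matchingCount : {n : ℕ} → ℕ → Graph (Fin n) → ℕ
matchingCount t G = countTrue pairwiseDisjoint (choose t (edgeList G))

-- Extremal numbers, as "m is the maximum" relations

IsEx : {V : Set} → ℕ → Graph V → ℕ → Set
IsEx n F m =
  (Σ (Graph (Fin n)) λ G → Free F G × edgeCount G ≡ m) ×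
  (∀ (G : Graph (Fin n)) → Free F G → edgeCount G ≤ m)

IsExMatching : {V : Set} → ℕ → ℕ → Graph V → ℕ → Set
IsExMatching n t F m =
  (Σ (Graph (Fin n)) λ G → Free F G × matchingCount t G ≡ m) ×
  (∀ (G : Graph (Fin n)) → Free F G → matchingCount t G ≤ m)

ℕtoℚ : ℕ → ℚ
ℕtoℚ m = + m / 1

powOverFact : ℕ → ℕ → ℚ
powOverFact e t = (+ (e ^ t) / (t !)) {{t !≢0}}

{-# OPTIONS --safe #-}
-- Let G be F-free with E ≤ e = ex(n, F) edges.  Trivially t! 𝒩(M_t, G) ≤ E^t, and since a
-- matching uses at most one edge at any vertex, a vertex of degree b improves this to
-- t! 𝒩(M_t, G) + b² E^(t-2) ≤ E^t.  So 𝒩(M_t, G) ≤ (1 − δ) e^t / t! unless E is close to e and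
-- every degree is a small fraction of E.  But then deleting fewer than |V(F)| vertices keeps
-- almost all edges, so by the hypothesis what remains has more than ex(n, Fᵢ) edges and contains
-- Fᵢ; embedding the components one after the other, each avoiding the vertices already used,
-- produces F in G.  Extremal numbers exist only classically, so this embedding is built in the
-- double-negation monad.
module Submission where

open import Defs hiding (sym)

-- ℕ's _<_ and _*_ are opened only inside this module, so that mainTheorem3 can use ℚ's.
module _ where

  open import Data.Bool using (Bool; true; false; not; _∧_; _∨_; if_then_else_)
  open import Data.Bool.Properties using (∨-comm; ∨-zeroʳ; ∧-zeroʳ; ∧-conicalˡ; ∧-conicalʳ; T-≡)
  open import Data.Bool.ListAction using (any)
  open import Data.Fin using (Fin; zero; suc; toℕ; _≟_)
  import Data.Fin.Properties as Fin
  open import Data.Integer as ℤ using (+[1+_]; -[1+_]; +<+; +≤+)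
  import Data.Integer.Properties as ℤ
  open import Data.List using (List; []; _∷_; _++_; map; length; allFin; concatMap; tabulate; lookup)
  open import Data.List.Properties using (length-++; length-tabulate)
  open import Data.List.Membership.Propositional using (_∈_; _∉_)
  open import Data.List.Membership.Propositional.Properties using (∈-tabulate⁺; ∈-allFin; ∈-++⁺ˡ; ∈-++⁺ʳ)
  open import Data.List.Relation.Unary.Any using (here; there; index; any?)
  open import Data.List.Relation.Unary.Any.Properties using (lookup-index)
  open import Data.Nat
    using (ℕ; zero; suc; pred; _+_; _*_; _^_; _!; _≤_; _<_; _≥_; _<ᵇ_; _≤?_; z≤n; s≤s; z<s; NonZero; >-nonZero)
  open import Data.Nat.Coprimality using (1-coprimeTo)
  open import Data.Nat.ListAction using (sum)
  open import Data.Nat.Properties hiding (_≟_)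
  open import Data.Nat.Solver using (module +-*-Solver)
  open import Data.Product using (Σ; ∃; _×_; _,_; proj₁; proj₂)
  open import Data.Rational as ℚ using (ℚ; mkℚ; 0ℚ; 1ℚ; _-_; -_; _/_; toℚᵘ; *<*; *≤*)
  import Data.Rational.Properties as ℚ
  open import Data.Rational.Unnormalised as ℚᵘ using (mkℚᵘ; *≡*) renaming (_≃_ to _≃ᵘ_; _<_ to _<ᵘ_)
  import Data.Rational.Unnormalised.Properties as ℚᵘ
  open import Data.Sum using (_⊎_; inj₁; inj₂)
  open import Effect.Monad using (RawMonad)
  open import Function using (_∘_; const; case_of_; _⇔_; mk⇔; Equivalence)
  open import Function.Definitions using (Injective)
  open import Level using (0ℓ)
  open import Relation.Nullary using (¬_; yes; no; contradiction)
  open import Relation.Nullary.Decidable using (does; dec-true; ¬¬-excluded-middle)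
  open import Relation.Nullary.Negation using (¬¬-Monad)
  open import Relation.Binary.PropositionalEquality

  open +-*-Solver
  open RawMonad (¬¬-Monad {0ℓ})

  private variable
    A B V : Set
    n : ℕ

  countTrue-false : ∀ (xs : List A) → countTrue (λ _ → false) xs ≡ 0
  countTrue-false []       = refl
  countTrue-false (x ∷ xs) = countTrue-false xs

  countTrue-true : ∀ (xs : List A) → countTrue (λ _ → true) xs ≡ length xs
  countTrue-true []       = refl
  countTrue-true (x ∷ xs) = cong suc (countTrue-true xs)

  module _ (p : A → Bool) where

    countTrue-++ : ∀ xs ys → countTrue p (xs ++ ys) ≡ countTrue p xs + countTrue p ys
    countTrue-++ []       ys = refl
    countTrue-++ (x ∷ xs) ys =
      trans (cong ((if p x then 1 else 0) +_) (countTrue-++ xs ys)) (sym (+-assoc (if p x then 1 else 0) _ _))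

    countTrue-map : (f : B → A) → ∀ xs → countTrue p (map f xs) ≡ countTrue (p ∘ f) xs
    countTrue-map f []       = refl
    countTrue-map f (x ∷ xs) = cong ((if p (f x) then 1 else 0) +_) (countTrue-map f xs)

    countTrue+countTrue-not : ∀ xs → countTrue p xs + countTrue (not ∘ p) xs ≡ length xs
    countTrue+countTrue-not []       = refl
    countTrue+countTrue-not (x ∷ xs) with p x
    ... | true  = cong suc (countTrue+countTrue-not xs)
    ... | false = trans (+-suc _ _) (cong suc (countTrue+countTrue-not xs))

    countTrue-cong : ∀ {q} → (∀ x → p x ≡ q x) → ∀ xs → countTrue p xs ≡ countTrue q xs
    countTrue-cong p≗q []       = refl
    countTrue-cong p≗q (x ∷ xs) = cong₂ (λ b m → (if b then 1 else 0) + m) (p≗q x) (countTrue-cong p≗q xs)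

    countTrue-mono : ∀ {q} → (∀ x → p x ≡ true → q x ≡ true) → ∀ xs → countTrue p xs ≤ countTrue q xs
    countTrue-mono         p⇒q []       = z≤n
    countTrue-mono {q = q} p⇒q (x ∷ xs) with p x in px | q x in qx
    ... | true  | true  = s≤s (countTrue-mono p⇒q xs)
    ... | true  | false with () ← trans (sym (p⇒q x px)) qx
    ... | false | true  = m≤n⇒m≤1+n (countTrue-mono p⇒q xs)
    ... | false | false = countTrue-mono p⇒q xs

    countTrue-∨ : ∀ q xs → countTrue (λ x → p x ∨ q x) xs ≤ countTrue p xs + countTrue q xs
    countTrue-∨ q []       = z≤n
    countTrue-∨ q (x ∷ xs) with p x | q x
    ... | true  | true  = s≤s (≤-trans (countTrue-∨ q xs) (+-monoʳ-≤ _ (n≤1+n _)))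
    ... | true  | false = s≤s (countTrue-∨ q xs)
    ... | false | true  = ≤-trans (s≤s (countTrue-∨ q xs)) (≤-reflexive (sym (+-suc _ _)))
    ... | false | false = countTrue-∨ q xs

  module _ {r : B → Bool} {f g : A → List B} (g≈f : ∀ x → length (g x) ≡ countTrue r (f x)) where

    length-concatMap≡countTrue : ∀ xs → length (concatMap g xs) ≡ countTrue r (concatMap f xs)
    length-concatMap≡countTrue []       = refl
    length-concatMap≡countTrue (x ∷ xs) = begin
      length (g x ++ concatMap g xs)                   ≡⟨ length-++ (g x) ⟩
      length (g x) + length (concatMap g xs)           ≡⟨ cong₂ _+_ (g≈f x) (length-concatMap≡countTrue xs) ⟩
      countTrue r (f x) + countTrue r (concatMap f xs) ≡⟨ countTrue-++ r (f x) _ ⟨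
      countTrue r (f x ++ concatMap f xs)              ∎
      where open ≡-Reasoning

  length-concatMap≤ : ∀ {f : A → List B} {c} → (∀ x → length (f x) ≤ c) → ∀ xs → length (concatMap f xs) ≤ length xs * c
  length-concatMap≤         f≤c []       = z≤n
  length-concatMap≤ {f = f} f≤c (x ∷ xs) =
    ≤-trans (≤-reflexive (length-++ (f x))) (+-mono-≤ (f≤c x) (length-concatMap≤ f≤c xs))

  -- Deleting vertices

  incident : Fin n → Fin n × Fin n → Bool
  incident v (a , b) = does (a ≟ v) ∨ does (b ≟ v)

  degree : Graph (Fin n) → Fin n → ℕ
  degree G v = countTrue (incident v) (edgeList G)

  touches : List (Fin n) → Fin n × Fin n → Bool
  touches U e = any (λ u → incident u e) U

  touches-swap : ∀ (U : List (Fin n)) a b → touches U (a , b) ≡ touches U (b , a)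
  touches-swap []      a b = refl
  touches-swap (u ∷ U) a b = cong₂ _∨_ (∨-comm (does (a ≟ u)) _) (touches-swap U a b)

  touches-∈ : ∀ {U : List (Fin n)} {a} b → a ∈ U → touches U (a , b) ≡ true
  touches-∈ {a = a} b (here refl) rewrite dec-true (a ≟ a) refl = refl
  touches-∈ {U = u ∷ _} {a} b (there a∈U) = trans (cong (incident u (a , b) ∨_) (touches-∈ b a∈U)) (∨-zeroʳ _)

  -- G ∖ U keeps the vertices of U, as isolated vertices, so that it is again a graph on Fin n.
  _∖_ : Graph (Fin n) → List (Fin n) → Graph (Fin n)
  G ∖ U = record
    { adj    = λ a b → adj G a b ∧ not (touches U (a , b))
    ; sym    = λ a b → cong₂ (λ x y → x ∧ not y) (Graph.sym G a b) (touches-swap U a b)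
    ; irrefl = λ a → cong (_∧ _) (irrefl G a)
    }

  edgeCount≤ : (G : Graph (Fin n)) → edgeCount G ≤ n * n
  edgeCount≤ {n} G = begin
    edgeCount G                                 ≤⟨ length-concatMap≤ (λ i → length-concatMap≤ (singleton≤1 i) (allFin n)) (allFin n) ⟩
    length (allFin n) * (length (allFin n) * 1) ≡⟨ cong (λ m → m * (m * 1)) (length-tabulate {n = n} (λ i → i)) ⟩
    n * (n * 1)                                 ≡⟨ cong (n *_) (*-identityʳ n) ⟩
    n * n                                       ∎
    where
    open ≤-Reasoning
    singleton≤1 : ∀ i j → length (if (toℕ i <ᵇ toℕ j) ∧ adj G i j then (i , j) ∷ [] else []) ≤ 1
    singleton≤1 i j with (toℕ i <ᵇ toℕ j) ∧ adj G i j
    ... | true  = ≤-refl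
    ... | false = z≤n

  module _ (G : Graph (Fin n)) (U : List (Fin n)) where

    ∖-adj : ∀ {a b} → adj (G ∖ U) a b ≡ true → adj G a b ≡ true × a ∉ U
    ∖-adj {a} {b} ab with adj G a b | touches U (a , b) in t
    ... | true | false = refl , λ a∈U → case trans (sym (touches-∈ b a∈U)) t of λ ()

    edgeCount-∖ : edgeCount (G ∖ U) ≡ countTrue (not ∘ touches U) (edgeList G)
    edgeCount-∖ = length-concatMap≡countTrue (λ i → length-concatMap≡countTrue (kept i) (allFin n)) (allFin n)
      where
      singleton : ∀ b {e : Fin n × Fin n} → length (if b then e ∷ [] else []) ≡ (if b then 1 else 0) + 0
      singleton true  = refl
      singleton false = refl
      kept : ∀ i j → length (if (toℕ i <ᵇ toℕ j) ∧ adj (G ∖ U) i j then (i , j) ∷ [] else [])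
                     ≡ countTrue (not ∘ touches U) (if (toℕ i <ᵇ toℕ j) ∧ adj G i j then (i , j) ∷ [] else [])
      kept i j with toℕ i <ᵇ toℕ j | adj G i j
      ... | true  | true  = singleton (not (touches U (i , j)))
      ... | true  | false = refl
      ... | false | _     = refl

    edgeCount-∖+removed : edgeCount (G ∖ U) + countTrue (touches U) (edgeList G) ≡ edgeCount G
    edgeCount-∖+removed = begin
      edgeCount (G ∖ U) + countTrue (touches U) L               ≡⟨ cong (_+ countTrue (touches U) L) edgeCount-∖ ⟩
      countTrue (not ∘ touches U) L + countTrue (touches U) L   ≡⟨ +-comm (countTrue (not ∘ touches U) L) _ ⟩
      countTrue (touches U) L + countTrue (not ∘ touches U) L   ≡⟨ countTrue+countTrue-not (touches U) L ⟩
      edgeCount G                                               ∎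
      where
      open ≡-Reasoning
      L = edgeList G

  module _ (G : Graph (Fin n)) {K : ℕ} (lowDegree : ∀ v → K * degree G v ≤ edgeCount G) where

    private
      E = edgeCount G
      L = edgeList G

    removedEdges≤ : ∀ U → K * countTrue (touches U) L ≤ length U * E
    removedEdges≤ []      = ≤-reflexive (trans (cong (K *_) (countTrue-false L)) (*-zeroʳ K))
    removedEdges≤ (u ∷ U) = begin
      K * countTrue (touches (u ∷ U)) L            ≤⟨ *-monoʳ-≤ K (countTrue-∨ (incident u) (touches U) L) ⟩
      K * (degree G u + countTrue (touches U) L)   ≡⟨ *-distribˡ-+ K _ _ ⟩
      K * degree G u + K * countTrue (touches U) L ≤⟨ +-mono-≤ (lowDegree u) (removedEdges≤ U) ⟩
      E + length U * E                             ∎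
      where open ≤-Reasoning

    edgeCount-∖-≥ : ∀ U → K * E ≤ K * edgeCount (G ∖ U) + length U * E
    edgeCount-∖-≥ U = begin
      K * E                                               ≡⟨ cong (K *_) (edgeCount-∖+removed G U) ⟨
      K * (edgeCount (G ∖ U) + countTrue (touches U) L)   ≡⟨ *-distribˡ-+ K _ _ ⟩
      K * edgeCount (G ∖ U) + K * countTrue (touches U) L ≤⟨ +-monoʳ-≤ _ (removedEdges≤ U) ⟩
      K * edgeCount (G ∖ U) + length U * E                ∎
      where open ≤-Reasoning

  -- Matchings

  -- Defs.choose appends with a local copy of _++_ that cannot be named, so the type of
  -- this helper is left to unification.
  local-++≡++ : ∀ {A : Set} (t : ℕ) (x : A) (xs : List A) (ys zs : List (List A)) → _ ≡ ys ++ zs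

  choose-suc-∷ : ∀ {A : Set} t (x : A) xs → choose (suc t) (x ∷ xs) ≡ map (x ∷_) (choose t xs) ++ choose (suc t) xs
  choose-suc-∷ t x xs with map (x ∷_) (choose t xs) | choose (suc t) xs
  ... | ys | zs = local-++≡++ t x xs ys zs

  local-++≡++ t x xs []       zs = refl
  local-++≡++ t x xs (y ∷ ys) zs = cong (y ∷_) (local-++≡++ t x xs ys zs)

  countTrue-choose-suc-∷ : ∀ (q : List A → Bool) t x xs →
    countTrue q (choose (suc t) (x ∷ xs)) ≡ countTrue (q ∘ (x ∷_)) (choose t xs) + countTrue q (choose (suc t) xs)
  countTrue-choose-suc-∷ q t x xs = begin
    countTrue q (choose (suc t) (x ∷ xs))                                    ≡⟨ cong (countTrue q) (choose-suc-∷ t x xs) ⟩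
    countTrue q (map (x ∷_) (choose t xs) ++ choose (suc t) xs)              ≡⟨ countTrue-++ q (map (x ∷_) (choose t xs)) _ ⟩
    countTrue q (map (x ∷_) (choose t xs)) + countTrue q (choose (suc t) xs) ≡⟨ cong (_+ _) (countTrue-map q (x ∷_) (choose t xs)) ⟩
    countTrue (q ∘ (x ∷_)) (choose t xs) + countTrue q (choose (suc t) xs)   ∎
    where open ≡-Reasoning

  binomial-suc : ∀ a t → suc t * a ^ t + a ^ suc t ≤ suc a ^ suc t
  binomial-suc a zero    = ≤-reflexive (solve 1 (λ a → con 1 :* con 1 :+ a :* con 1 := (con 1 :+ a) :* con 1) refl a)
  binomial-suc a (suc t) = begin
    suc (suc t) * (a * X) + a * (a * X)             ≤⟨ m≤m+n _ (suc t * X) ⟩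
    suc (suc t) * (a * X) + a * (a * X) + suc t * X ≡⟨ solve 3 (λ a X t →
        (con 2 :+ t) :* (a :* X) :+ a :* (a :* X) :+ (con 1 :+ t) :* X
     := (con 1 :+ a) :* ((con 1 :+ t) :* X :+ a :* X)) refl a X t ⟩
    suc a * (suc t * X + a * X)                     ≤⟨ *-monoʳ-≤ (suc a) (binomial-suc a t) ⟩
    suc a * suc a ^ suc t                           ∎
    where
    open ≤-Reasoning
    X = a ^ t

  binomial-suc′ : ∀ a t → t * a ^ pred t + a ^ t ≤ suc a ^ t
  binomial-suc′ a zero    = ≤-refl
  binomial-suc′ a (suc t) = binomial-suc a t

  binomial-+ : ∀ a b u → a ^ suc (suc u) + suc (suc u) * b * a ^ suc u + b * b * (a + b) ^ u ≤ (a + b) ^ suc (suc u)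
  binomial-+ a b zero    = ≤-reflexive (solve 2 (λ a b →
        a :* (a :* con 1) :+ con 2 :* b :* (a :* con 1) :+ b :* b :* con 1
     := (a :+ b) :* ((a :+ b) :* con 1)) refl a b)
  binomial-+ a b (suc u) = begin
    a * (a * X) + (3 + u) * b * (a * X) + b * b * ((a + b) * Y)                       ≤⟨ m≤m+n _ ((2 + u) * b * b * X) ⟩
    a * (a * X) + (3 + u) * b * (a * X) + b * b * ((a + b) * Y) + (2 + u) * b * b * X ≡⟨ solve 5 (λ a b u X Y →
        a :* (a :* X) :+ (con 3 :+ u) :* b :* (a :* X) :+ b :* b :* ((a :+ b) :* Y) :+ (con 2 :+ u) :* b :* b :* X
     := (a :+ b) :* (a :* X :+ (con 2 :+ u) :* b :* X :+ b :* b :* Y)) refl a b u X Y ⟩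
    (a + b) * (a * X + (2 + u) * b * X + b * b * Y)                                   ≤⟨ *-monoʳ-≤ (a + b) (binomial-+ a b u) ⟩
    (a + b) * (a + b) ^ suc (suc u)                                                   ∎
    where
    open ≤-Reasoning
    X = a ^ suc u
    Y = (a + b) ^ u

  !*countTrue-choose-suc-∷ : ∀ (q : List A → Bool) {q′} t x xs → (∀ l → q (x ∷ l) ≡ q′ l) →
    suc t ! * countTrue q (choose (suc t) (x ∷ xs))
      ≡ suc t * (t ! * countTrue q′ (choose t xs)) + suc t ! * countTrue q (choose (suc t) xs)
  !*countTrue-choose-suc-∷ q {q′} t x xs q[x∷]≗q′ = begin
    suc t ! * countTrue q (choose (suc t) (x ∷ xs))          ≡⟨ cong (suc t ! *_) (countTrue-choose-suc-∷ q t x xs) ⟩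
    suc t ! * (countTrue (q ∘ (x ∷_)) (choose t xs) + M)     ≡⟨ cong (λ m → suc t ! * (m + M)) (countTrue-cong _ q[x∷]≗q′ (choose t xs)) ⟩
    suc t ! * (countTrue q′ (choose t xs) + M)               ≡⟨ *-distribˡ-+ (suc t !) _ M ⟩
    suc t ! * countTrue q′ (choose t xs) + suc t ! * M       ≡⟨ cong (_+ suc t ! * M) (*-assoc (suc t) (t !) _) ⟩
    suc t * (t ! * countTrue q′ (choose t xs)) + suc t ! * M ∎
    where
    open ≡-Reasoning
    M = countTrue q (choose (suc t) xs)

  module _ (q : A → Bool) where

    allB-choose : ∀ t xs → t ! * countTrue (allB q) (choose t xs) ≤ countTrue q xs ^ t
    allB-choose zero    xs       = ≤-refl
    allB-choose (suc t) []       = ≤-trans (≤-reflexive (*-zeroʳ (suc t !))) z≤n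
    allB-choose (suc t) (x ∷ xs) with q x in qx
    ... | false = begin
      suc t ! * countTrue (allB q) (choose (suc t) (x ∷ xs))     ≡⟨ cong (suc t ! *_) (countTrue-choose-suc-∷ (allB q) t x xs) ⟩
      suc t ! * (countTrue (allB q ∘ (x ∷_)) (choose t xs) + M) ≡⟨ cong (λ m → suc t ! * (m + M)) withoutHead ⟩
      suc t ! * (0 + M)                                          ≤⟨ allB-choose (suc t) xs ⟩
      countTrue q xs ^ suc t                                     ∎
      where
      open ≤-Reasoning
      M = countTrue (allB q) (choose (suc t) xs)
      withoutHead : countTrue (allB q ∘ (x ∷_)) (choose t xs) ≡ 0
      withoutHead = trans (countTrue-cong _ (λ l → cong (_∧ allB q l) qx) (choose t xs)) (countTrue-false (choose t xs))
    ... | true = begin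
      suc t ! * countTrue (allB q) (choose (suc t) (x ∷ xs))
        ≡⟨ !*countTrue-choose-suc-∷ (allB q) t x xs (λ l → cong (_∧ allB q l) qx) ⟩
      suc t * (t ! * countTrue (allB q) (choose t xs)) + suc t ! * countTrue (allB q) (choose (suc t) xs)
        ≤⟨ +-mono-≤ (*-monoʳ-≤ (suc t) (allB-choose t xs)) (allB-choose (suc t) xs) ⟩
      suc t * countTrue q xs ^ t + countTrue q xs ^ suc t
        ≤⟨ binomial-suc (countTrue q xs) t ⟩
      suc (countTrue q xs) ^ suc t
        ∎
      where open ≤-Reasoning

  atMostOneOf : (A → Bool) → List A → Bool
  atMostOneOf p []       = true
  atMostOneOf p (x ∷ xs) = if p x then allB (not ∘ p) xs else atMostOneOf p xs

  atMostOneOf-step : ∀ a b t → suc t * (a ^ t + t * b * a ^ pred t) + (a ^ suc t + suc t * b * a ^ t)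
                               ≤ suc a ^ suc t + suc t * b * suc a ^ t
  atMostOneOf-step a b t = begin
    suc t * (a ^ t + t * b * a ^ pred t) + (a ^ suc t + suc t * b * a ^ t)
      ≡⟨ solve 5 (λ t a b X Y →
             (con 1 :+ t) :* (X :+ t :* b :* Y) :+ (a :* X :+ (con 1 :+ t) :* b :* X)
          := ((con 1 :+ t) :* X :+ a :* X) :+ (con 1 :+ t) :* b :* (t :* Y :+ X)) refl t a b (a ^ t) (a ^ pred t) ⟩
    (suc t * a ^ t + a ^ suc t) + suc t * b * (t * a ^ pred t + a ^ t)
      ≤⟨ +-mono-≤ (binomial-suc a t) (*-monoʳ-≤ (suc t * b) (binomial-suc′ a t)) ⟩
    suc a ^ suc t + suc t * b * suc a ^ t
      ∎
    where open ≤-Reasoning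

  module _ (p : A → Bool) where

    atMostOneOf-choose : ∀ t xs → let a = countTrue (not ∘ p) xs; b = countTrue p xs in
      t ! * countTrue (atMostOneOf p) (choose t xs) ≤ a ^ t + t * b * a ^ pred t
    atMostOneOf-choose zero    xs       = ≤-refl
    atMostOneOf-choose (suc t) []       = ≤-trans (≤-reflexive (*-zeroʳ (suc t !))) z≤n
    atMostOneOf-choose (suc t) (x ∷ xs) with p x in px
    ... | true = begin
      suc t ! * countTrue (atMostOneOf p) (choose (suc t) (x ∷ xs))
        ≡⟨ !*countTrue-choose-suc-∷ (atMostOneOf p) t x xs (λ l → cong (if_then allB (not ∘ p) l else atMostOneOf p l) px) ⟩
      suc t * (t ! * countTrue (allB (not ∘ p)) (choose t xs)) + suc t ! * countTrue (atMostOneOf p) (choose (suc t) xs)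
        ≤⟨ +-mono-≤ (*-monoʳ-≤ (suc t) (allB-choose (not ∘ p) t xs)) (atMostOneOf-choose (suc t) xs) ⟩
      suc t * a ^ t + (a ^ suc t + suc t * b * a ^ t)
        ≡⟨ solve 4 (λ t a b X → (con 1 :+ t) :* X :+ (a :* X :+ (con 1 :+ t) :* b :* X)
                             := a :* X :+ (con 1 :+ t) :* (con 1 :+ b) :* X) refl t a b (a ^ t) ⟩
      a ^ suc t + suc t * suc b * a ^ t
        ∎
      where
      open ≤-Reasoning
      a = countTrue (not ∘ p) xs
      b = countTrue p xs
    ... | false = begin
      suc t ! * countTrue (atMostOneOf p) (choose (suc t) (x ∷ xs))
        ≡⟨ !*countTrue-choose-suc-∷ (atMostOneOf p) t x xs (λ l → cong (if_then allB (not ∘ p) l else atMostOneOf p l) px) ⟩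
      suc t * (t ! * countTrue (atMostOneOf p) (choose t xs)) + suc t ! * countTrue (atMostOneOf p) (choose (suc t) xs)
        ≤⟨ +-mono-≤ (*-monoʳ-≤ (suc t) (atMostOneOf-choose t xs)) (atMostOneOf-choose (suc t) xs) ⟩
      suc t * (a ^ t + t * b * a ^ pred t) + (a ^ suc t + suc t * b * a ^ t)
        ≤⟨ atMostOneOf-step a b t ⟩
      suc a ^ suc t + suc t * b * suc a ^ t
        ∎
      where
      open ≤-Reasoning
      a = countTrue (not ∘ p) xs
      b = countTrue p xs

  allB-true : ∀ (xs : List A) → allB (λ _ → true) xs ≡ true
  allB-true []       = refl
  allB-true (x ∷ xs) = allB-true xs

  allB-mono : ∀ {p q : A → Bool} → (∀ x → p x ≡ true → q x ≡ true) → ∀ xs → allB p xs ≡ true → allB q xs ≡ true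
  allB-mono         p⇒q []       _   = refl
  allB-mono {p = p} p⇒q (x ∷ xs) all =
    cong₂ _∧_ (p⇒q x (∧-conicalˡ (p x) _ all)) (allB-mono p⇒q xs (∧-conicalʳ (p x) _ all))

  neq-refl : (v : Fin n) → neq v v ≡ false
  neq-refl v rewrite Equivalence.to T-≡ (≡⇒≡ᵇ (toℕ v) (toℕ v) refl) = refl

  incident-endpoint : ∀ {v a b : Fin n} → incident v (a , b) ≡ true → a ≡ v ⊎ b ≡ v
  incident-endpoint {v = v} {a} {b} _ with a ≟ v | b ≟ v
  ... | yes a≡v | _       = inj₁ a≡v
  ... | no _    | yes b≡v = inj₂ b≡v

  incident-¬disjoint : ∀ {v : Fin n} e e′ → incident v e ≡ true → incident v e′ ≡ true → disjointEdges e e′ ≡ false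
  incident-¬disjoint {v = v} (a , b) (c , d) ve ve′ with incident-endpoint {v = v} {a} {b} ve | incident-endpoint {v = v} {c} {d} ve′
  ... | inj₁ refl | inj₁ refl rewrite neq-refl a = refl
  ... | inj₁ refl | inj₂ refl rewrite neq-refl a = ∧-zeroʳ (neq a c)
  ... | inj₂ refl | inj₁ refl rewrite neq-refl b = trans (cong (neq a c ∧_) (∧-zeroʳ (neq a d))) (∧-zeroʳ (neq a c))
  ... | inj₂ refl | inj₂ refl rewrite neq-refl b =
    trans (cong (λ z → neq a c ∧ (neq a d ∧ z)) (∧-zeroʳ (neq b c)))
          (trans (cong (neq a c ∧_) (∧-zeroʳ (neq a d))) (∧-zeroʳ (neq a c)))

  pairwiseDisjoint⇒atMostOneOf : ∀ {p : Fin n × Fin n → Bool} →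
    (∀ e e′ → p e ≡ true → p e′ ≡ true → disjointEdges e e′ ≡ false) →
    ∀ es → pairwiseDisjoint es ≡ true → atMostOneOf p es ≡ true
  pairwiseDisjoint⇒atMostOneOf         clash []       _  = refl
  pairwiseDisjoint⇒atMostOneOf {p = p} clash (e ∷ es) pd with p e in pe
  ... | true  = allB-mono avoids es (∧-conicalˡ (allB (disjointEdges e) es) _ pd)
    where
    avoids : ∀ e′ → disjointEdges e e′ ≡ true → not (p e′) ≡ true
    avoids e′ d with p e′ in pe′
    ... | true  = case trans (sym d) (clash e e′ pe pe′) of λ ()
    ... | false = refl
  ... | false = pairwiseDisjoint⇒atMostOneOf clash es (∧-conicalʳ (allB (disjointEdges e) es) _ pd)

  module _ (G : Graph (Fin n)) where

    private
      E = edgeCount G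
      L = edgeList G

    matchingCount≤ : ∀ t → t ! * matchingCount t G ≤ E ^ t
    matchingCount≤ t = begin
      t ! * matchingCount t G                          ≤⟨ *-monoʳ-≤ (t !) anything ⟩
      t ! * countTrue (allB (λ _ → true)) (choose t L) ≤⟨ allB-choose (λ _ → true) t L ⟩
      countTrue (λ _ → true) L ^ t                     ≡⟨ cong (_^ t) (countTrue-true L) ⟩
      E ^ t                                            ∎
      where
      open ≤-Reasoning
      anything : matchingCount t G ≤ countTrue (allB (λ _ → true)) (choose t L)
      anything = countTrue-mono pairwiseDisjoint (λ S _ → allB-true S) (choose t L)

    matchingCount≤-degree : ∀ u v → let t = 2 + u; b = degree G v in
      t ! * matchingCount t G + b * b * E ^ u ≤ E ^ t
    matchingCount≤-degree u v = subst (λ E → t ! * matchingCount t G + b * b * E ^ u ≤ E ^ t) a+b≡E (begin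
      t ! * matchingCount t G + b * b * (a + b) ^ u
        ≤⟨ +-monoˡ-≤ _ (*-monoʳ-≤ (t !) atMostOne) ⟩
      t ! * countTrue (atMostOneOf (incident v)) (choose t L) + b * b * (a + b) ^ u
        ≤⟨ +-monoˡ-≤ _ (atMostOneOf-choose (incident v) t L) ⟩
      a ^ t + t * b * a ^ suc u + b * b * (a + b) ^ u
        ≤⟨ binomial-+ a b u ⟩
      (a + b) ^ t
        ∎)
      where
      open ≤-Reasoning
      t = 2 + u
      a = countTrue (not ∘ incident v) L
      b = degree G v
      a+b≡E : a + b ≡ E
      a+b≡E = trans (+-comm a b) (countTrue+countTrue-not (incident v) L)
      atMostOne : matchingCount t G ≤ countTrue (atMostOneOf (incident v)) (choose t L)
      atMostOne = countTrue-mono pairwiseDisjoint (pairwiseDisjoint⇒atMostOneOf incident-¬disjoint) (choose t L)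

  -- Extremal numbers

  ¬¬-maximum : (P : ℕ → Set) {m : ℕ} → P m → ∀ B → (∀ m → P m → m ≤ B) →
    ¬ ¬ (∃ λ m → P m × ∀ m′ → P m′ → m′ ≤ m)
  ¬¬-maximum P {m} Pm zero    ≤B = pure (m , Pm , λ m′ Pm′ → ≤-trans (≤B m′ Pm′) z≤n)
  ¬¬-maximum P     Pm (suc B) ≤B = do
    P[1+B]? ← ¬¬-excluded-middle
    case P[1+B]? of λ where
      (yes P[1+B]) → pure (suc B , P[1+B] , ≤B)
      (no ¬P[1+B]) → ¬¬-maximum P Pm B λ m′ Pm′ →
        ≤-pred (≤∧≢⇒< (≤B m′ Pm′) (λ m′≡1+B → ¬P[1+B] (subst P m′≡1+B Pm′)))

  ¬¬-ex : (H : Graph V) (G : Graph (Fin n)) → Free H G → ¬ ¬ ∃ (IsEx n H)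
  ¬¬-ex {n = n} H G free = do
    (e , witness , maximal) ← ¬¬-maximum HasFreeGraph (G , free , refl) (n * n)
                                (λ m (G′ , _ , G′≡m) → subst (_≤ n * n) G′≡m (edgeCount≤ G′))
    pure (e , witness , λ G′ free′ → maximal (edgeCount G′) (G′ , free′ , refl))
    where
    HasFreeGraph : ℕ → Set
    HasFreeGraph m = Σ (Graph (Fin n)) λ G′ → Free H G′ × edgeCount G′ ≡ m

  aboveEx⇒¬Free : (H : Graph V) (G : Graph (Fin n)) → (∀ e → IsEx n H e → e < edgeCount G) → ¬ Free H G
  aboveEx⇒¬Free H G above free = ¬¬-ex H G free λ (e , isEx) →
    <-irrefl refl (<-≤-trans (above e isEx) (proj₂ isEx G free))

  -- Embedding the forest

  IsEmbedding : {W : Set} → Graph V → Graph W → (V → W) → Set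
  IsEmbedding H G f = Injective _≡_ _≡_ f × (∀ x y → adj H x y ≡ true → adj G (f x) (f y) ≡ true)

  CopyAvoiding : Graph (Fin n) → Graph V → List (Fin n) → Set
  CopyAvoiding {n = n} {V = V} G H U = Σ (V → Fin n) λ f → IsEmbedding H G f × (∀ x → f x ∉ U)

  vertex∉ : (U : List (Fin n)) → length U < n → ∃ λ v → v ∉ U
  vertex∉ {n} U |U|<n = Fin.¬∀⟶∃¬ n (_∈ U) (λ v → any? (v ≟_) U) λ all∈U →
    let (i , j , i<j , same) = Fin.pigeonhole |U|<n (index ∘ all∈U) in
    Fin.<⇒≢ i<j (trans (lookup-index (all∈U i)) (trans (cong (lookup U) same) (sym (lookup-index (all∈U j)))))

  neighbour : ∀ {w} (H : Graph (Fin (suc (suc w)))) → Connected H → ∀ x → ∃ λ y → adj H x y ≡ true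
  neighbour H connected zero with connected zero (suc zero)
  ... | step {y = y} xy _ = y , xy
  neighbour H connected (suc x) with connected (suc x) zero
  ... | step {y = y} xy _ = y , xy

  -- A one-vertex component only needs a vertex outside U.  A larger one avoids U because each
  -- of its vertices has a neighbour, while G ∖ U has no edges at U.
  ¬¬-copyAvoiding : ∀ {w} (H : Graph (Fin (suc w))) → Connected H → (G : Graph (Fin n)) (U : List (Fin n)) →
    length U + suc w ≤ n → ¬ Free H (G ∖ U) → ¬ ¬ CopyAvoiding G H U
  ¬¬-copyAvoiding {w = zero} H _ G U room _ with vertex∉ U (≤-trans (≤-reflexive (+-comm 1 (length U))) room)
  ... | v , v∉U = pure (const v , ((λ {x} {y} → singleVertex {x} {y}) , noLoop) , λ _ → v∉U)
    where
    singleVertex : Injective {A = Fin 1} _≡_ _≡_ (const v)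
    singleVertex {zero} {zero} _ = refl
    noLoop : ∀ x y → adj H x y ≡ true → adj G v v ≡ true
    noLoop zero zero loop = contradiction (trans (sym loop) (irrefl H zero)) λ ()
  ¬¬-copyAvoiding {w = suc w} H connected G U _ notFree = do
    (f , embedding) ← notFree
    pure (f , ∖-embedding embedding , λ x → let (y , xy) = neighbour H connected x in
                                           proj₂ (∖-adj G U (proj₂ embedding x y xy)))
    where
    ∖-embedding : ∀ {f} → IsEmbedding H (G ∖ U) f → IsEmbedding H G f
    ∖-embedding (injective , edges) = injective , λ x y xy → proj₁ (∖-adj G U (edges x y xy))

  order : ∀ {k} → (Fin k → ℕ) → List (Fin k) → ℕ
  order vs I = sum (map (λ i → suc (vs i)) I)

  module Greedy (G : Graph (Fin n)) {k} {vs : Fin k → ℕ} (T : (i : Fin k) → Graph (Fin (suc (vs i)))) where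

    record PartialCopy (I : List (Fin k)) (U : List (Fin n)) : Set where
      field
        copy     : ∀ {i} → i ∈ I → Fin (suc (vs i)) → Fin n
        embeds   : ∀ {i} (p : i ∈ I) → IsEmbedding (T i) G (copy p)
        avoids   : ∀ {i} (p : i ∈ I) x → copy p x ∉ U
        disjoint : ∀ {i j} (p : i ∈ I) (q : j ∈ I) → i ≢ j → ∀ x y → copy p x ≢ copy q y

    extend : ∀ {h I U} ((f , _) : CopyAvoiding G (T h) U) → PartialCopy I (tabulate f ++ U) → PartialCopy (h ∷ I) U
    extend {h} {I} {U} (f , f-embeds , f-avoids) rest = record
      { copy     = λ { (here refl) → f ; (there p) → R.copy p }
      ; embeds   = λ { (here refl) → f-embeds ; (there p) → R.embeds p }
      ; avoids   = λ { (here refl) → f-avoids ; (there p) → λ x → R.avoids p x ∘ ∈-++⁺ʳ (tabulate f) }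
      ; disjoint = λ where
          (here refl) (here refl) h≢h → contradiction refl h≢h
          (here refl) (there q)   _ x y fx≡ → clash q x y fx≡
          (there p)   (here refl) _ x y ≡fy → clash p y x (sym ≡fy)
          (there p)   (there q)   i≢j → R.disjoint p q i≢j
      }
      where
      module R = PartialCopy rest
      clash : ∀ {j} (q : j ∈ I) x y → f x ≢ R.copy q y
      clash q x y fx≡ = R.avoids q y (subst (_∈ tabulate f ++ U) fx≡ (∈-++⁺ˡ (∈-tabulate⁺ {f = f} x)))

    module _ {s} (copyAvoiding : ∀ i U → length U + suc (vs i) ≤ s → ¬ ¬ CopyAvoiding G (T i) U) where

      ¬¬-partialCopy : ∀ I U → length U + order vs I ≤ s → ¬ ¬ PartialCopy I U
      ¬¬-partialCopy []      U _    = pure (record { copy = λ () ; embeds = λ () ; avoids = λ () ; disjoint = λ () })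
      ¬¬-partialCopy (h ∷ I) U room = do
        c ← copyAvoiding h U (≤-trans (+-monoʳ-≤ (length U) (m≤m+n (suc (vs h)) (order vs I))) room)
        rest ← ¬¬-partialCopy I (tabulate (proj₁ c) ++ U) (≤-trans (≤-reflexive (rearrange (proj₁ c))) room)
        pure (extend c rest)
        where
        rearrange : ∀ f → length (tabulate f ++ U) + order vs I ≡ length U + order vs (h ∷ I)
        rearrange f = begin
          length (tabulate f ++ U) + order vs I       ≡⟨ cong (_+ order vs I) (length-++ (tabulate f)) ⟩
          length (tabulate f) + length U + order vs I ≡⟨ cong (λ m → m + length U + order vs I) (length-tabulate f) ⟩
          suc (vs h) + length U + order vs I          ≡⟨ cong (_+ order vs I) (+-comm (suc (vs h)) (length U)) ⟩
          length U + suc (vs h) + order vs I          ≡⟨ +-assoc (length U) (suc (vs h)) (order vs I) ⟩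
          length U + order vs (h ∷ I)                 ∎
          where open ≡-Reasoning

    partialCopy⇒contains : PartialCopy (allFin k) [] → Contains G (DisjointUnion k vs T)
    partialCopy⇒contains pc = f , (λ {a} {b} → injective {a} {b}) , edges
      where
      open PartialCopy pc
      f : Σ (Fin k) (λ i → Fin (suc (vs i))) → Fin n
      f (i , x) = copy (∈-allFin i) x
      injective : Injective _≡_ _≡_ f
      injective {i , x} {j , y} fx≡fy with i ≟ j
      ... | yes refl = cong (i ,_) (proj₁ (embeds (∈-allFin i)) fx≡fy)
      ... | no i≢j   = contradiction fx≡fy (disjoint (∈-allFin i) (∈-allFin j) i≢j x y)
      edges : ∀ a b → adj (DisjointUnion k vs T) a b ≡ true → adj G (f a) (f b) ≡ true
      edges (i , x) (j , y) xy with i ≟ j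
      ... | yes refl = proj₂ (embeds (∈-allFin i)) x y xy

    ¬Free-forest : (∀ i U → length U + suc (vs i) ≤ order vs (allFin k) → ¬ ¬ CopyAvoiding G (T i) U) →
      ¬ Free (DisjointUnion k vs T) G
    ¬Free-forest copyAvoiding free = ¬¬-partialCopy copyAvoiding (allFin k) [] ≤-refl (free ∘ partialCopy⇒contains)

  -- c * x + y ≤ c * y says x ≤ (1 − 1/c) y, with denominators cleared.
  fraction-monoˡ : ∀ {c d x y} → 1 ≤ c → c ≤ d → c * x + y ≤ c * y → d * x + y ≤ d * y
  fraction-monoˡ {c} {d} {x} {y} 1≤c c≤d cx+y≤cy with m≤n⇒∃[o]m+o≡n c≤d
  ... | o , refl = begin
    (c + o) * x + y     ≡⟨ solve 4 (λ c o x y → (c :+ o) :* x :+ y := (c :* x :+ y) :+ o :* x) refl c o x y ⟩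
    (c * x + y) + o * x ≤⟨ +-mono-≤ cx+y≤cy (*-monoʳ-≤ o x≤y) ⟩
    c * y + o * y       ≡⟨ *-distribʳ-+ y c o ⟨
    (c + o) * y         ∎
    where
    open ≤-Reasoning
    x≤y : x ≤ y
    x≤y = *-cancelˡ-≤ c {{>-nonZero 1≤c}} (≤-trans (m≤m+n (c * x) y) cx+y≤cy)

  fraction-monoʳ : ∀ {c x y z} → 1 ≤ c → c * x + y ≤ c * y → y ≤ z → c * x + z ≤ c * z
  fraction-monoʳ {c} {x} {y} {z} 1≤c cx+y≤cy y≤z with m≤n⇒∃[o]m+o≡n y≤z
  ... | o , refl = begin
    c * x + (y + o) ≡⟨ +-assoc (c * x) y o ⟨
    c * x + y + o   ≤⟨ +-mono-≤ cx+y≤cy (m≤n*m o c {{>-nonZero 1≤c}}) ⟩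
    c * y + c * o   ≡⟨ *-distribˡ-+ c y o ⟨
    c * (y + o)     ∎
    where open ≤-Reasoning

  fraction-strict : ∀ {c x y} → 1 ≤ y → c * x + y ≤ c * y → suc (2 * c) * x < 2 * c * y
  fraction-strict {c} {x} {y} 1≤y cx+y≤cy = begin-strict
    suc (2 * c) * x     ≡⟨ solve 2 (λ c x → (con 1 :+ con 2 :* c) :* x := x :+ con 2 :* (c :* x)) refl c x ⟩
    x + 2 * (c * x)     <⟨ +-monoˡ-< (2 * (c * x)) (<-≤-trans x<y (m≤m+n y (y + 0))) ⟩
    2 * y + 2 * (c * x) ≡⟨ solve 3 (λ y c x → con 2 :* y :+ con 2 :* (c :* x) := con 2 :* (c :* x :+ y)) refl y c x ⟩
    2 * (c * x + y)     ≤⟨ *-monoʳ-≤ 2 cx+y≤cy ⟩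
    2 * (c * y)         ≡⟨ *-assoc 2 c y ⟨
    2 * c * y           ∎
    where
    open ≤-Reasoning
    x<y : x < y
    x<y = ≰⇒> λ y≤x → <⇒≱ 1≤y (+-cancelˡ-≤ (c * y) y 0
            (≤-trans (+-monoˡ-≤ y (*-monoʳ-≤ c y≤x)) (≤-trans cx+y≤cy (≤-reflexive (sym (+-identityʳ (c * y)))))))

  sparse-pow : ∀ {c E e} u → c * E + e ≤ c * e → E ≤ e → c * E ^ suc u + e ^ suc u ≤ c * e ^ suc u
  sparse-pow {c} {E} {e} u sparse E≤e = begin
    c * (E * E ^ u) + e * e ^ u ≤⟨ +-monoˡ-≤ _ (*-monoʳ-≤ c (*-monoʳ-≤ E (^-monoˡ-≤ u E≤e))) ⟩
    c * (E * e ^ u) + e * e ^ u ≡⟨ solve 4 (λ c E e Y → c :* (E :* Y) :+ e :* Y := (c :* E :+ e) :* Y) refl c E e (e ^ u) ⟩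
    (c * E + e) * e ^ u         ≤⟨ *-monoˡ-≤ (e ^ u) sparse ⟩
    c * e * e ^ u               ≡⟨ *-assoc c e (e ^ u) ⟩
    c * (e * e ^ u)             ∎
    where open ≤-Reasoning

  deletion-cancel : ∀ {c s r E E′} → r ≤ suc s → c * suc s * E ≤ c * suc s * E′ + r * E → c * E ≤ c * E′ + E
  deletion-cancel {c} {s} {r} {E} {E′} r≤1+s deleted = *-cancelˡ-≤ (suc s) (begin
    suc s * (c * E)            ≡⟨ solve 3 (λ s c E → (con 1 :+ s) :* (c :* E) := c :* (con 1 :+ s) :* E) refl s c E ⟩
    c * suc s * E              ≤⟨ deleted ⟩
    c * suc s * E′ + r * E     ≤⟨ +-monoʳ-≤ _ (*-monoˡ-≤ E r≤1+s) ⟩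
    c * suc s * E′ + suc s * E ≡⟨ solve 4 (λ s c E′ E → c :* (con 1 :+ s) :* E′ :+ (con 1 :+ s) :* E
                                                     := (con 1 :+ s) :* (c :* E′ :+ E)) refl s c E′ E ⟩
    suc s * (c * E′ + E)       ∎)
    where open ≤-Reasoning

  dense-deletion : ∀ {a e E E′} → let c = 2 * suc a in
    c * e < c * E + e → c * E ≤ c * E′ + E → E ≤ e → a * e < suc a * E′
  dense-deletion {a} {e} {E} {E′} dense deleted E≤e = +-cancelˡ-< e (a * e) (suc a * E′)
    (*-cancelˡ-< (4 * a′) (suc a * e) (e + suc a * E′) (begin-strict
      4 * a′ * (a′ * e)        ≡⟨ solve 2 (λ A e → con 4 :* A :* (A :* e) := con 2 :* A :* (con 2 :* A :* e)) refl a′ e ⟩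
      c * (c * e)              <⟨ *-monoʳ-< c dense ⟩
      c * (c * E + e)          ≡⟨ *-distribˡ-+ c (c * E) e ⟩
      c * (c * E) + c * e      ≤⟨ +-monoˡ-≤ (c * e) (*-monoʳ-≤ c deleted) ⟩
      c * (c * E′ + E) + c * e ≤⟨ +-monoˡ-≤ (c * e) (*-monoʳ-≤ c (+-monoʳ-≤ (c * E′) E≤e)) ⟩
      c * (c * E′ + e) + c * e ≡⟨ solve 3 (λ A E′ e → con 2 :* A :* (con 2 :* A :* E′ :+ e) :+ con 2 :* A :* e
                                                   := con 4 :* A :* (e :+ A :* E′)) refl a′ E′ e ⟩
      4 * a′ * (e + a′ * E′)   ∎))
    where
    open ≤-Reasoning
    a′ = suc a
    c = 2 * a′

  -- Rationals

  1/suc : ℕ → ℚ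
  1/suc d = mkℚ (ℤ.+ 1) d (1-coprimeTo (suc d))

  1/suc-pos : ∀ d → 0ℚ ℚ.< 1/suc d
  1/suc-pos d = *<* (+<+ (s≤s z≤n))

  1/suc≤ : ∀ α → 0ℚ ℚ.< α → ∃ λ d → 1/suc d ℚ.≤ α
  1/suc≤ (mkℚ +[1+ p ]    d _) _ = d , *≤* (subst₂ ℤ._≤_ (ℤ.pos-* 1 (suc d)) (ℤ.pos-* (suc p) (suc d))
                                              (+≤+ (*-monoˡ-≤ (suc d) {1} {suc p} (s≤s z≤n))))
  1/suc≤ (mkℚ (ℤ.+ 0)     _ _) (*<* (+<+ ()))
  1/suc≤ (mkℚ -[1+ _ ]    _ _) (*<* ())

  mkℚᵘ-<⇔ : ∀ a b c d → mkℚᵘ (ℤ.+ a) b <ᵘ mkℚᵘ (ℤ.+ c) d ⇔ a * suc d < c * suc b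
  mkℚᵘ-<⇔ a b c d = mk⇔
    (λ { (ℚᵘ.*<* lt) → ℤ.drop‿+<+ (subst₂ ℤ._<_ (sym (ℤ.pos-* a (suc d))) (sym (ℤ.pos-* c (suc b))) lt) })
    (λ lt → ℚᵘ.*<* (subst₂ ℤ._<_ (ℤ.pos-* a (suc d)) (ℤ.pos-* c (suc b)) (+<+ lt)))

  toℚᵘ-/ : ∀ y D .{{_ : NonZero D}} → toℚᵘ (ℤ.+ y / D) ≃ᵘ mkℚᵘ (ℤ.+ y) (pred D)
  toℚᵘ-/ y (suc D) = ℚ.toℚᵘ-fromℚᵘ (mkℚᵘ (ℤ.+ y) D)

  toℚᵘ-1-1/suc : ∀ d → toℚᵘ (1ℚ - 1/suc d) ≃ᵘ mkℚᵘ (ℤ.+ d) d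
  toℚᵘ-1-1/suc d = ℚᵘ.≃-trans (ℚ.toℚᵘ-homo-+ 1ℚ (- 1/suc d))
    (ℚᵘ.≃-trans (ℚᵘ.+-congʳ (toℚᵘ 1ℚ) (ℚ.toℚᵘ-homo‿- (1/suc d)))
      (*≡* (trans (cong (λ m → ℤ.+ m ℤ.* ℤ.+ suc d) (+-identityʳ d))
                  (cong (λ m → ℤ.+ d ℤ.* ℤ.+ suc m) (sym (+-identityʳ d))))))

  <-1-1/suc⇔ : ∀ x d y D .{{_ : NonZero D}} → ℕtoℚ x ℚ.< (1ℚ - 1/suc d) ℚ.* (ℤ.+ y / D) ⇔ suc d * (D * x) < d * y
  <-1-1/suc⇔ x d y D@(suc D′) = mk⇔
    (λ lt → arith (Equivalence.to (mkℚᵘ-<⇔ x 0 (d * y) M) (ℚᵘ.<-respˡ-≃ lhs (ℚᵘ.<-respʳ-≃ rhs (ℚ.toℚᵘ-mono-< lt)))))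
    (λ lt → ℚ.toℚᵘ-cancel-< (ℚᵘ.<-respˡ-≃ (ℚᵘ.≃-sym lhs) (ℚᵘ.<-respʳ-≃ (ℚᵘ.≃-sym rhs)
              (Equivalence.from (mkℚᵘ-<⇔ x 0 (d * y) M) (arith⁻¹ lt)))))
    where
    M = D′ + d * D
    lhs : toℚᵘ (ℕtoℚ x) ≃ᵘ mkℚᵘ (ℤ.+ x) 0
    lhs = toℚᵘ-/ x 1
    rhs : toℚᵘ ((1ℚ - 1/suc d) ℚ.* (ℤ.+ y / D)) ≃ᵘ mkℚᵘ (ℤ.+ (d * y)) M
    rhs = ℚᵘ.≃-trans (ℚ.toℚᵘ-homo-* (1ℚ - 1/suc d) (ℤ.+ y / D))
            (ℚᵘ.≃-trans (ℚᵘ.*-cong (toℚᵘ-1-1/suc d) (toℚᵘ-/ y D))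
              (ℚᵘ.≃-reflexive (cong (λ n → mkℚᵘ n M) (sym (ℤ.pos-* d y)))))
    same : x * suc M ≡ suc d * (D * x)
    same = trans (*-comm x (suc d * D)) (*-assoc (suc d) D x)
    arith : x * suc M < d * y * 1 → suc d * (D * x) < d * y
    arith = subst₂ _<_ same (*-identityʳ (d * y))
    arith⁻¹ : suc d * (D * x) < d * y → x * suc M < d * y * 1
    arith⁻¹ = subst₂ _<_ (sym same) (sym (*-identityʳ (d * y)))

  <-1-α⇒ : ∀ α → 0ℚ ℚ.< α → ∃ λ a → ∀ x y → ℕtoℚ x ℚ.< (1ℚ - α) ℚ.* ℕtoℚ y → suc a * x < a * y
  <-1-α⇒ α 0<α with 1/suc≤ α 0<α
  ... | d , 1/suc[d]≤α = d , λ x y lt →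
    subst (λ m → suc d * m < d * y) (*-identityˡ x)
      (Equivalence.to (<-1-1/suc⇔ x d y 1) (ℚ.<-≤-trans lt
        (ℚ.*-monoʳ-≤-nonNeg (ℕtoℚ y) {{ℚ.normalize-nonNeg y 1}} (ℚ.+-monoʳ-≤ 1ℚ (ℚ.neg-antimono-≤ 1/suc[d]≤α)))))

  -- The counting argument

  module _ {k} {vs : Fin k → ℕ} {T : (i : Fin k) → Graph (Fin (suc (vs i)))} (connected : ∀ i → Connected (T i)) where

    private
      F = DisjointUnion k vs T
      s = order vs (allFin k)

    robust⇒¬Free : (G : Graph (Fin n)) → s ≤ n →
      (∀ U → length U < s → ∀ i eᵢ → IsEx n (T i) eᵢ → eᵢ < edgeCount (G ∖ U)) → ¬ Free F G
    robust⇒¬Free G s≤n robust = Greedy.¬Free-forest G T λ i U room →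
      ¬¬-copyAvoiding (T i) (connected i) G U (≤-trans room s≤n)
        (aboveEx⇒¬Free (T i) (G ∖ U) (robust U (<-≤-trans (m<m+n (length U) z<s) room) i))

    -- If E ≤ (1 − 1/c) e the trivial bound suffices.  Otherwise, if all degrees are at most E/K,
    -- deleting fewer than s vertices keeps more than a/(a + 1) · e edges; and Q = K² makes the
    -- bound at a vertex of degree ≥ E/K as good.
    module Counting (a : ℕ) where

      c K Q q : ℕ
      c = 2 * suc a
      K = c * suc s
      Q = K * K
      q = 2 * Q

      module _ (s≤n : s ≤ n) {e} (exF : IsEx n F e)
               (sparseComponents : ∀ i eᵢ → IsEx n (T i) eᵢ → suc a * eᵢ < a * e) where

        1≤e : 1 ≤ e
        1≤e = n≢0⇒n>0 λ e≡0 → robust⇒¬Free G₀ s≤n (λ _ _ i eᵢ exᵢ →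
          contradiction (subst (λ e → suc a * eᵢ < a * e) e≡0 (sparseComponents i eᵢ exᵢ))
                        (λ lt → n≮0 (<-≤-trans lt (≤-reflexive (*-zeroʳ a))))) free₀
          where
          G₀ : Graph (Fin n)
          G₀ = proj₁ (proj₁ exF)
          free₀ : Free F G₀
          free₀ = proj₁ (proj₂ (proj₁ exF))

        module _ (G : Graph (Fin n)) (free : Free F G) where

          private
            E : ℕ
            E = edgeCount G
            E≤e : E ≤ e
            E≤e = proj₂ exF G free

          lowDegree⇒sparse : (∀ v → K * degree G v ≤ E) → c * E + e ≤ c * e
          lowDegree⇒sparse lowDegree = ≮⇒≥ λ dense → robust⇒¬Free G s≤n (robust dense) free
            where
            robust : c * e < c * E + e → ∀ U → length U < s → ∀ i eᵢ → IsEx n (T i) eᵢ → eᵢ < edgeCount (G ∖ U)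
            robust dense U |U|<s i eᵢ exᵢ = *-cancelˡ-< (suc a) eᵢ (edgeCount (G ∖ U))
              (<-trans (sparseComponents i eᵢ exᵢ) (dense-deletion {a = a} dense deleted E≤e))
              where
              deleted : c * E ≤ c * edgeCount (G ∖ U) + E
              deleted = deletion-cancel {c = c} {s = s} (≤-trans (<⇒≤ |U|<s) (n≤1+n s)) (edgeCount-∖-≥ G {K = K} lowDegree U)

          matchingCount-fraction : ∀ u → let t = 2 + u in Q * (t ! * matchingCount t G) + e ^ t ≤ Q * e ^ t
          matchingCount-fraction u with Fin.any? (λ v → E ≤? K * degree G v)
          ... | yes (v , E≤Kb) = fraction-monoʳ {c = Q} (s≤s z≤n) (begin
            Q * x + E * (E * E ^ u)         ≤⟨ +-monoʳ-≤ (Q * x) (*-mono-≤ E≤Kb (*-monoˡ-≤ (E ^ u) E≤Kb)) ⟩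
            Q * x + K * b * (K * b * E ^ u) ≡⟨ solve 4 (λ K x b Z → K :* K :* x :+ K :* b :* (K :* b :* Z)
                                                                 := K :* K :* (x :+ b :* b :* Z)) refl K x b (E ^ u) ⟩
            Q * (x + b * b * E ^ u)         ≤⟨ *-monoʳ-≤ Q (matchingCount≤-degree G u v) ⟩
            Q * E ^ (2 + u)                 ∎) (^-monoˡ-≤ (2 + u) E≤e)
            where
            open ≤-Reasoning
            x = (2 + u) ! * matchingCount (2 + u) G
            b = degree G v
          ... | no ¬highDegree = fraction-monoˡ {c = c} {d = Q} (s≤s z≤n) (≤-trans (m≤m*n c (suc s)) (m≤m*n K K)) (begin
            c * x + e ^ t     ≤⟨ +-monoˡ-≤ (e ^ t) (*-monoʳ-≤ c (matchingCount≤ G t)) ⟩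
            c * E ^ t + e ^ t ≤⟨ sparse-pow {c = c} (suc u) (lowDegree⇒sparse lowDegree) E≤e ⟩
            c * e ^ t         ∎)
            where
            open ≤-Reasoning
            t = 2 + u
            x = t ! * matchingCount t G
            lowDegree : ∀ v → K * degree G v ≤ E
            lowDegree v = <⇒≤ (≰⇒> λ E≤Kb → ¬highDegree (v , E≤Kb))

      matchingCount-bound : ∀ N → (∀ n → n ≥ N → ∀ i e eᵢ → IsEx n F e → IsEx n (T i) eᵢ → suc a * eᵢ < a * e) →
        ∀ u n → n ≥ N + s → ∀ e m → IsEx n F e → IsExMatching n (2 + u) F m → suc q * ((2 + u) ! * m) < q * e ^ (2 + u)
      matchingCount-bound N sparseComponents u n n≥N+s e _ exF ((G , free , refl) , _) =
        fraction-strict {c = Q} (m^n>0 e {{>-nonZero (1≤e s≤n exF sparse)}} (2 + u)) (matchingCount-fraction s≤n exF sparse G free u)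
        where
        s≤n : s ≤ n
        s≤n = ≤-trans (m≤n+m s N) n≥N+s
        sparse : ∀ i eᵢ → IsEx n (T i) eᵢ → suc a * eᵢ < a * e
        sparse i eᵢ = sparseComponents n (≤-trans (m≤m+n N s) n≥N+s) i e eᵢ exF

open import Data.Nat as ℕ using (ℕ; suc; _≤_; _≥_; s≤s; z≤n; _!)
open import Data.Nat.Properties using (_!≢0)
open import Data.Fin using (Fin)
open import Data.Product using (Σ; _×_; _,_; proj₁)
open import Data.Rational using (ℚ; 0ℚ; 1ℚ; _<_; _-_; _*_)
open import Data.List using (allFin)
open import Function using (_∘_; Equivalence)

mainTheorem3 : (t : ℕ) → 2 ≤ t →
    (k : ℕ) (vs : Fin k → ℕ) (T : (i : Fin k) → Graph (Fin (suc (vs i)))) →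
    (∀ i → IsTree (T i)) →
    (Σ ℚ λ α → (0ℚ < α) × (Σ ℕ λ N → ∀ n → n ≥ N → ∀ (i : Fin k) (e eᵢ : ℕ) →
        IsEx n (DisjointUnion k vs T) e → IsEx n (T i) eᵢ →
        ℕtoℚ eᵢ < (1ℚ - α) * ℕtoℚ e)) →
    Σ ℚ λ α′ → (0ℚ < α′) × (Σ ℕ λ N → ∀ n → n ≥ N → ∀ (e m : ℕ) →
        IsEx n (DisjointUnion k vs T) e → IsExMatching n t (DisjointUnion k vs T) m →
        ℕtoℚ m < (1ℚ - α′) * powOverFact e t)
mainTheorem3 t@(suc (suc u)) (s≤s (s≤s z≤n)) k vs T trees (α , 0<α , N , belowα) with <-1-α⇒ α 0<α
... | a , fromℚ = 1/suc q , 1/suc-pos q , N ℕ.+ order vs (allFin k) , λ n n≥ e m exF exM →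
  Equivalence.from (<-1-1/suc⇔ m q (e ℕ.^ t) (t !) {{t !≢0}})
    (matchingCount-bound N (λ n n≥N i e eᵢ exF exᵢ → fromℚ eᵢ e (belowα n n≥N i e eᵢ exF exᵢ)) u n n≥ e m exF exM)
  where open Counting (proj₁ ∘ trees) a
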